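{- Let $D$ be a minimal counterexample to the conjecture described in the context, $C$ its Hamilton cycle, and $x$ a vertex of $D$ none of whose incident edges is green, such that the edge from $x^-$ to $x$ is red (i.e. $x^-\in R^-(x)$). Then the sets $B^+_b(x)$ and $B^-_b(x)$ are nonempty.
   Context: A 3-coloured tournament is a finite tournament each of whose edges is coloured red, blue or green. A triple of vertices spans a $T_3$ if the three edges between them form a directed cycle with three distinct colours. For distinct vertices $u,v$, $u$ monochromatically dominates $v$ in colour $c$ if there is a directed path from $u$ to $v$ all of whose edges have colour $c$. The conjecture: every 3-coloured tournament has a triple spanning a $T_3$ or a vertex monochromatically dominating every other vertex. A minimal counterexample is a 3-coloured tournament $D$ with no $T_3$ and no vertex dominating all others, such that every proper nonempty subtournament has a $T_3$ or a vertex monochromatically dominating all its other vertices within it. Such $D$ has a unique directed Hamilton cycle $C$ such that each vertex monochromatically dominates every vertex except its predecessor on $C$; $x^-$ denotes the predecessor of $x$ on $C$. Notation: $R^+(x)$ (resp. $R^-(x)$) is the set of vertices to which $x$ sends a red edge (resp. from which $x$ receives a red edge); $B^+(x)$, $B^-(x)$ are defined analogously for blue. For $i\in\{r,b\}$ (red, blue): $R^-_i(x)=\{v\in R^-(x): x \text{ dominates } v \text{ monochromatically in colour } i\}$, $R^+_i(x)=\{v\in R^+(x): v \text{ dominates } x \text{ monochromatically in colour } i\}$, and $B^-_i(x)$, $B^+_i(x)$ are defined analogously with $B^\pm(x)$ in place of $R^\pm(x)$. -}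

module Defs where

open import Data.Nat using (ℕ)
open import Data.Fin using (Fin)
open import Data.Fin.Subset using (Subset; _∈_; _∉_; ⊤; Nonempty)
open import Data.Bool using (Bool; true; false; not)
open import Data.Product using (Σ; ∃; _×_; _,_)
open import Data.Sum using (_⊎_)
open import Function using (_∘_)
open import Relation.Binary.PropositionalEquality using (_≡_; _≢_)
open import Relation.Nullary using (¬_)

data Colour : Set where
  red blue green : Colour

-- A 3-coloured tournament on the vertex set Fin n.
-- arc u v ≡ true  means the edge between u and v is directed u → v.
-- col u v is the colour of the (unique) edge between u and v (symmetric).
record Tournament3 (n : ℕ) : Set where
  field
    arc      : Fin n → Fin n → Bool
    col      : Fin n → Fin n → Colour
    arc-irr  : ∀ u → arc u u ≡ false
    arc-tour : ∀ u v → u ≢ v → arc v u ≡ not (arc u v)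
    col-sym  : ∀ u v → col u v ≡ col v u

module _ {n : ℕ} (D : Tournament3 n) where
  open Tournament3 D

  Edge : Fin n → Fin n → Colour → Set
  Edge u v c = (arc u v ≡ true) × (col u v ≡ c)

  -- a directed walk from u to v all of whose edges have colour c and all
  -- of whose internal vertices lie in S (a walk contains a path, so this
  -- is the same as the existence of a monochromatic directed path).
  data MonoPath (S : Subset n) (c : Colour) : Fin n → Fin n → Set where
    one  : ∀ {u v} → Edge u v c → MonoPath S c u v
    step : ∀ {u w v} → Edge u w c → w ∈ S → MonoPath S c w v → MonoPath S c u v

  DomIn : Subset n → Colour → Fin n → Fin n → Set
  DomIn S c u v = MonoPath S c u v

  Dom : Colour → Fin n → Fin n → Set
  Dom = DomIn ⊤

  Distinct3 : Colour → Colour → Colour → Set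
  Distinct3 c₁ c₂ c₃ = (c₁ ≢ c₂) × (c₂ ≢ c₃) × (c₁ ≢ c₃)

  HasT3In : Subset n → Set
  HasT3In S = Σ (Fin n) λ a → Σ (Fin n) λ b → Σ (Fin n) λ d →
    (a ∈ S) × (b ∈ S) × (d ∈ S) ×
    (arc a b ≡ true) × (arc b d ≡ true) × (arc d a ≡ true) ×
    Distinct3 (col a b) (col b d) (col d a)

  HasKingIn : Subset n → Set
  HasKingIn S = Σ (Fin n) λ v → (v ∈ S) ×
    (∀ w → w ∈ S → w ≢ v → ∃ λ c → DomIn S c v w)

  GoodIn : Subset n → Set
  GoodIn S = HasT3In S ⊎ HasKingIn S

  MinimalCounterexample : Set
  MinimalCounterexample =
    ¬ GoodIn ⊤ ×
    (∀ (S : Subset n) → Nonempty S → (∃ λ v → v ∉ S) → GoodIn S)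

  iter : (Fin n → Fin n) → ℕ → Fin n → Fin n
  iter f ℕ.zero    = λ u → u
  iter f (ℕ.suc k) = f ∘ iter f k

  -- pre : Fin n → Fin n is the predecessor map of a directed Hamilton cycle
  -- C of D: each pre v → v is an arc, and the map is a single cycle through
  -- all vertices.
  IsHamiltonPred : (Fin n → Fin n) → Set
  IsHamiltonPred pre =
    (∀ v → arc (pre v) v ≡ true) ×
    (∀ u v → ∃ λ k → iter pre k u ≡ v)

  DominatesAllButPred : (Fin n → Fin n) → Set
  DominatesAllButPred pre =
    ∀ u v → v ≢ u → v ≢ pre u → ∃ λ c → Dom c u v

  B⁺b-nonempty : Fin n → Set
  B⁺b-nonempty x = ∃ λ v → Edge x v blue × Dom blue v x

  B⁻b-nonempty : Fin n → Set
  B⁻b-nonempty x = ∃ λ v → Edge v x blue × Dom blue x v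

module Submission where

-- B⁺_b(x) is obtained from B⁻_b(x) in any tournament: if v → x is blue and
-- x ⇝ w ⇝ v is a blue path, then w ∈ B⁺_b(x) via w ⇝ v → x.  For B⁻_b(x)
-- it suffices to find a blue in-neighbour v of x that x does not dominate in
-- red: since v ≠ x⁻ and x has no green edges, x then dominates v in blue.
--   * If x has a red out-neighbour, let S be x together with the vertices x
--     does not dominate in red.  S is a proper subtournament, so it has a
--     king w.  w = x, or w dominates x in red, would make a king of D; so w
--     reaches x in blue inside S, and the last edge of that path is wanted.
--   * Otherwise all out-edges of x are blue.  If no in-edge is blue, all are
--     red, and the successor y of x on C dominates x⁻: in red it would dominate
--     x, in blue x would dominate x⁻, and in green a rainbow triangle through x
--     appears.  So some in-edge is blue, and x does not dominate in red at all.

open import Defs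
open import Data.Nat using (ℕ; zero; suc; _<_; s≤s)
open import Data.Nat.Properties using (≤-pred; ≤∧≢⇒<; m≤n⇒m≤1+n; ≤-reflexive)
  renaming (_≟_ to _≟ℕ_)
open import Data.Fin using (Fin; toℕ) renaming (_≟_ to _≟F_)
open import Data.Fin.Properties using (any?; toℕ-injective; toℕ<n)
open import Data.Fin.Subset using (Subset; _∈_; _∉_; ⊤)
open import Data.Fin.Subset.Properties using (∈⊤)
open import Data.Vec using (tabulate)
open import Data.Vec.Properties using (lookup∘tabulate; []=⇒lookup; lookup⇒[]=)
open import Data.Bool using (true; false; not)
open import Data.Bool.Properties using () renaming (_≟_ to _≟B_)
open import Data.Product using (∃; _×_; _,_; proj₁; proj₂)
open import Data.Sum using (_⊎_; inj₁; inj₂; [_,_])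
open import Data.Empty using (⊥; ⊥-elim)
open import Relation.Nullary using (¬_; Dec; yes; no; does)
open import Relation.Nullary.Decidable using (_×-dec_; _⊎-dec_; ¬?; dec-true)
open import Relation.Binary.PropositionalEquality
  using (_≡_; _≢_; refl; sym; trans; subst; cong)

_≟C_ : (a b : Colour) → Dec (a ≡ b)
red   ≟C red   = yes refl
red   ≟C blue  = no λ ()
red   ≟C green = no λ ()
blue  ≟C red   = no λ ()
blue  ≟C blue  = yes refl
blue  ≟C green = no λ ()
green ≟C red   = no λ ()
green ≟C blue  = no λ ()
green ≟C green = yes refl

notRedGreen⇒blue : ∀ {c} → c ≢ red → c ≢ green → c ≡ blue
notRedGreen⇒blue {red}   ¬r _  = ⊥-elim (¬r refl)
notRedGreen⇒blue {blue}  _  _  = refl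
notRedGreen⇒blue {green} _  ¬g = ⊥-elim (¬g refl)

notBlueGreen⇒red : ∀ {c} → c ≢ blue → c ≢ green → c ≡ red
notBlueGreen⇒red {red}   _  _  = refl
notBlueGreen⇒red {blue}  ¬b _  = ⊥-elim (¬b refl)
notBlueGreen⇒red {green} _  ¬g = ⊥-elim (¬g refl)

module _ {n : ℕ} {P : Fin n → Set} (P? : ∀ i → Dec (P i)) where

  select : Subset n
  select = tabulate (λ i → does (P? i))

  ∈-select : ∀ {i} → P i → i ∈ select
  ∈-select {i} p = lookup⇒[]= i select (trans (lookup∘tabulate _ i) (dec-true (P? i) p))

  select-∈ : ∀ {i} → i ∈ select → P i
  select-∈ {i} i∈ with P? i | trans (sym (lookup∘tabulate (λ j → does (P? j)) i)) ([]=⇒lookup i∈)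
  ... | yes p | _ = p
  ... | no _  | ()

module Tournament {n : ℕ} (D : Tournament3 n) where
  open Tournament3 D

  arc⇒≢ : ∀ {u v} → arc u v ≡ true → u ≢ v
  arc⇒≢ {u} uv refl with trans (sym uv) (arc-irr u)
  ... | ()

  arc-asym : ∀ {u v} → arc u v ≡ true → arc v u ≡ true → ⊥
  arc-asym {u} {v} uv vu with trans (sym vu) (trans (arc-tour u v (arc⇒≢ uv)) (cong not uv))
  ... | ()

  arc-total : ∀ {u v} → u ≢ v → arc u v ≡ true ⊎ arc v u ≡ true
  arc-total {u} {v} u≢v with arc u v in uv
  ... | true  = inj₁ refl
  ... | false = inj₂ (trans (arc-tour u v u≢v) (cong not uv))

  edge? : ∀ c u v → Dec (Edge D u v c)
  edge? c u v = (arc u v ≟B true) ×-dec (col u v ≟C c)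

  edge-colour : ∀ {u v c c′} → Edge D u v c → Edge D u v c′ → c ≡ c′
  edge-colour (_ , refl) (_ , refl) = refl

  _▷_by_ : ∀ {S c a b d} → MonoPath D S c a b → b ∈ S → Edge D b d c → MonoPath D S c a d
  one e      ▷ b∈ by e′ = step e b∈ (one e′)
  step e m p ▷ b∈ by e′ = step e m (p ▷ b∈ by e′)

  _++_via_ : ∀ {S c a b d} → MonoPath D S c a b → MonoPath D S c b d → b ∈ S → MonoPath D S c a d
  one e      ++ q via b∈ = step e b∈ q
  step e m p ++ q via b∈ = step e m (p ++ q via b∈)

  widen : ∀ {S c a b} → MonoPath D S c a b → Dom D c a b
  widen (one e)      = one e
  widen (step e _ p) = step e ∈⊤ (widen p)

  firstEdge : ∀ {S c a b} → MonoPath D S c a b → ∃ λ w → Edge D a w c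
  firstEdge (one e)      = _ , e
  firstEdge (step e _ _) = _ , e

  lastEdge : ∀ {S c a b} → a ∈ S → MonoPath D S c a b → ∃ λ v → v ∈ S × Edge D v b c
  lastEdge a∈ (one e)       = _ , a∈ , e
  lastEdge _  (step _ w∈ p) = lastEdge w∈ p

  widenT3 : ∀ {S} → HasT3In D S → HasT3In D ⊤
  widenT3 (a , b , d , _ , _ , _ , rest) = a , b , d , ∈⊤ , ∈⊤ , ∈⊤ , rest

  -- If v → x is blue and x ⇝ v is a blue path, its first edge x → w gives
  -- w ∈ B⁺_b(x), because w ⇝ v → x is a blue path.
  B⁻⇒B⁺ : ∀ {x} → B⁻b-nonempty D x → B⁺b-nonempty D x
  B⁻⇒B⁺ (v , vx , one xv)      = v , xv , one vx
  B⁻⇒B⁺ (v , vx , step xw _ p) = _ , xw , p ▷ ∈⊤ by vx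

-- Monochromatic domination is decidable (a Floyd–Warshall argument): Below k
-- are the c-coloured walks all of whose internal vertices have index < k.
module Reachability {n : ℕ} (D : Tournament3 n) (c : Colour) where
  open Tournament D using (edge?)

  data Below (k : ℕ) : Fin n → Fin n → Set where
    one  : ∀ {u v} → Edge D u v c → Below k u v
    step : ∀ {u w v} → Edge D u w c → toℕ w < k → Below k w v → Below k u v

  below-suc : ∀ {k u v} → Below k u v → Below (suc k) u v
  below-suc (one e)        = one e
  below-suc (step e w<k p) = step e (m≤n⇒m≤1+n w<k) (below-suc p)

  below-++ : ∀ {k u w v} → Below k u w → toℕ w < k → Below k w v → Below k u v
  below-++ (one e)         w<k q = step e w<k q
  below-++ (step e w′<k p) w<k q = step e w′<k (below-++ p w<k q)

  below-split : ∀ {k u v} → Below (suc k) u v →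
    Below k u v ⊎ (∃ λ w → toℕ w ≡ k × Below k u w × Below k w v)
  below-split (one e) = inj₁ (one e)
  below-split {k} {u} (step {w = w} e w<k+1 p) with toℕ w ≟ℕ k | below-split p
  ... | yes w≡k | inj₁ q = inj₂ (w , w≡k , one e , q)
  ... | yes w≡k | inj₂ (w′ , w′≡k , _ , q) =
    inj₂ (w′ , w′≡k , subst (Below k u) (toℕ-injective (trans w≡k (sym w′≡k))) (one e) , q)
  ... | no w≢k | inj₁ q = inj₁ (step e (≤∧≢⇒< (≤-pred w<k+1) w≢k) q)
  ... | no w≢k | inj₂ (w′ , w′≡k , q₁ , q₂) =
    inj₂ (w′ , w′≡k , step e (≤∧≢⇒< (≤-pred w<k+1) w≢k) q₁ , q₂)

  below? : ∀ k u v → Dec (Below k u v)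
  below? zero u v with edge? c u v
  ... | yes e = yes (one e)
  ... | no ¬e = no λ { (one e) → ¬e e ; (step _ () _) }
  below? (suc k) u v with below? k u v
  ... | yes p = yes (below-suc p)
  ... | no ¬p with any? (λ w → (toℕ w ≟ℕ k) ×-dec (below? k u w ×-dec below? k w v))
  ...   | yes (w , w≡k , p₁ , p₂) = yes (below-++ (below-suc p₁) (s≤s (≤-reflexive w≡k)) (below-suc p₂))
  ...   | no ¬q = no λ r → [ ¬p , ¬q ] (below-split r)

  -- Every walk has internal vertices of index < n, so Below n is Dom.
  dom⇒below : ∀ {S u v} → MonoPath D S c u v → Below n u v
  dom⇒below (one e)              = one e
  dom⇒below (step {w = w} e _ p) = step e (toℕ<n w) (dom⇒below p)

  below⇒dom : ∀ {k u v} → Below k u v → Dom D c u v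
  below⇒dom (one e)      = one e
  below⇒dom (step e _ p) = step e ∈⊤ (below⇒dom p)

  dom? : ∀ u v → Dec (Dom D c u v)
  dom? u v with below? n u v
  ... | yes p = yes (below⇒dom p)
  ... | no ¬p = no λ q → ¬p (dom⇒below q)

module MinimalCounterexampleFacts {n : ℕ} (D : Tournament3 n) (mc : MinimalCounterexample D)
  (pre : Fin n → Fin n) (ham : IsHamiltonPred D pre) (domAll : DominatesAllButPred D pre) where
  open Tournament D

  noRainbow : ∀ {a b d c₁ c₂ c₃} → Edge D a b c₁ → Edge D b d c₂ → Edge D d a c₃ →
    Distinct3 D c₁ c₂ c₃ → ⊥
  noRainbow {a} {b} {d} (ab , refl) (bd , refl) (da , refl) distinct =
    proj₁ mc (inj₁ (a , b , d , ∈⊤ , ∈⊤ , ∈⊤ , ab , bd , da , distinct))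

  noKing : ∀ v → (∀ w → w ≢ v → ∃ λ c → Dom D c v w) → ⊥
  noKing v king = proj₁ mc (inj₂ (v , ∈⊤ , λ w _ w≢v → king w w≢v))

  noDomPre : ∀ {u c} → Dom D c u (pre u) → ⊥
  noDomPre {u} {c} u⇝pre = noKing u king
    where
    king : ∀ w → w ≢ u → ∃ λ c → Dom D c u w
    king w w≢u with w ≟F pre u
    ... | yes refl = c , u⇝pre
    ... | no w≢pre = domAll u w w≢u w≢pre

  successor : ∀ u → ∃ λ y → pre y ≡ u
  successor u with proj₂ ham (pre u) u
  ... | zero  , pre≡u = ⊥-elim (arc⇒≢ (proj₁ ham u) pre≡u)
  ... | suc k , eq    = iter D pre k (pre u) , eq

module AtVertex {n : ℕ} (D : Tournament3 n) (mc : MinimalCounterexample D)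
  (pre : Fin n → Fin n) (ham : IsHamiltonPred D pre) (domAll : DominatesAllButPred D pre)
  (x : Fin n) (noGreen : ∀ v → v ≢ x → Tournament3.col D x v ≢ green)
  (preEdge : Edge D (pre x) x red) where
  open Tournament3 D
  open Tournament D
  open MinimalCounterexampleFacts D mc pre ham domAll

  noGreenIn : ∀ {v} → ¬ Edge D v x green
  noGreenIn {v} (vx , g) = noGreen v (arc⇒≢ vx) (trans (col-sym x v) g)

  noGreenDom : ∀ {v} → ¬ Dom D green x v
  noGreenDom x⇝v with firstEdge x⇝v
  ... | w , (xw , g) = noGreen w (λ w≡x → arc⇒≢ xw (sym w≡x)) g

  -- The key step: a blue in-neighbour v of x that x does not dominate in red
  -- differs from x⁻, so x dominates it, necessarily in blue.
  blueInNeighbour : ∀ {v} → Edge D v x blue → ¬ Dom D red x v → B⁻b-nonempty D x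
  blueInNeighbour {v} vx ¬red with domAll x v (arc⇒≢ (proj₁ vx)) v≢pre
    where
    v≢pre : v ≢ pre x
    v≢pre refl with edge-colour preEdge vx
    ... | ()
  ... | red   , x⇝v = ⊥-elim (¬red x⇝v)
  ... | blue  , x⇝v = v , vx , x⇝v
  ... | green , x⇝v = ⊥-elim (noGreenDom x⇝v)

  module WithRedOut (u₀ : Fin n) (xu₀ : Edge D x u₀ red) where
    open Reachability D red using (dom?)

    inS? : ∀ u → Dec (u ≡ x ⊎ ¬ Dom D red x u)
    inS? u = (u ≟F x) ⊎-dec ¬? (dom? x u)

    S : Subset n
    S = select inS?

    x∈S : x ∈ S
    x∈S = ∈-select inS? (inj₁ refl)

    notRedDominated : ∀ {v} → v ∈ S → v ≢ x → ¬ Dom D red x v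
    notRedDominated v∈S v≢x = [ (λ v≡x → ⊥-elim (v≢x v≡x)) , (λ ¬d → ¬d) ] (select-∈ inS? v∈S)

    u₀∉S : u₀ ∉ S
    u₀∉S u₀∈S = notRedDominated u₀∈S (λ u₀≡x → arc⇒≢ (proj₁ xu₀) (sym u₀≡x)) (one xu₀)

    kingOfD : ∀ {w} → (∀ v → v ∈ S → v ≢ w → ∃ λ c → DomIn D S c w v) →
      (∀ {v} → Dom D red x v → Dom D red w v) → ⊥
    kingOfD {w} kingS reach = noKing w king
      where
      king : ∀ v → v ≢ w → ∃ λ c → Dom D c w v
      king v v≢w with dom? x v
      ... | yes x⇝v = red , reach x⇝v
      ... | no ¬x⇝v with kingS v (∈-select inS? (inj₂ ¬x⇝v)) v≢w
      ...   | c , w⇝v = c , widen w⇝v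

    fromKing : HasKingIn D S → B⁻b-nonempty D x
    fromKing (w , w∈S , kingS) with w ≟F x
    ... | yes refl = ⊥-elim (kingOfD kingS (λ x⇝v → x⇝v))
    ... | no w≢x with kingS x x∈S (λ x≡w → w≢x (sym x≡w))
    ...   | red   , w⇝x = ⊥-elim (kingOfD kingS (λ x⇝v → widen w⇝x ++ x⇝v via ∈⊤))
    ...   | green , w⇝x = ⊥-elim (noGreenIn (proj₂ (proj₂ (lastEdge w∈S w⇝x))))
    ...   | blue  , w⇝x with lastEdge w∈S w⇝x
    ...     | v , v∈S , vx = blueInNeighbour vx (notRedDominated v∈S (arc⇒≢ (proj₁ vx)))

    result : B⁻b-nonempty D x
    result with proj₂ mc S (x , x∈S) (u₀ , u₀∉S)
    ... | inj₁ t3   = ⊥-elim (proj₁ mc (inj₁ (widenT3 t3)))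
    ... | inj₂ king = fromKing king

  module WithoutRedOut (noRedOut : ∀ {u} → ¬ Edge D x u red) where

    noRedDom : ∀ {v} → ¬ Dom D red x v
    noRedDom x⇝v = noRedOut (proj₂ (firstEdge x⇝v))

    blueOut : ∀ {a} → arc x a ≡ true → Edge D x a blue
    blueOut {a} xa = xa , notRedGreen⇒blue (λ r → noRedOut (xa , r))
                                           (noGreen a (λ a≡x → arc⇒≢ xa (sym a≡x)))

    blueDom : ∀ {v} → v ≢ x → v ≢ pre x → Dom D blue x v
    blueDom {v} v≢x v≢pre with domAll x v v≢x v≢pre
    ... | red   , x⇝v = ⊥-elim (noRedDom x⇝v)
    ... | blue  , x⇝v = x⇝v
    ... | green , x⇝v = ⊥-elim (noGreenDom x⇝v)

    -- If moreover every in-edge of x is red, the successor y of x cannot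
    -- dominate x⁻ in any colour, contradicting DominatesAllButPred.
    module WithoutBlueIn (noBlueIn : ∀ {v} → ¬ Edge D v x blue) where

      redIn : ∀ {b} → arc b x ≡ true → Edge D b x red
      redIn {b} bx = bx , notBlueGreen⇒red (λ bl → noBlueIn (bx , bl))
                                            (λ g → noGreen b (arc⇒≢ bx) (trans (col-sym x b) g))

      -- A green walk from an out-neighbour to an in-neighbour of x has an
      -- edge from an out-neighbour to an in-neighbour, closing a rainbow
      -- triangle (blue, green, red) through x.
      noGreenDetour : ∀ {a b} → arc x a ≡ true → arc b x ≡ true → Dom D green a b → ⊥
      noGreenDetour xa bx (one ab) = noRainbow (blueOut xa) ab (redIn bx) ((λ ()) , (λ ()) , (λ ()))
      noGreenDetour xa bx (step aw _ w⇝b) =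
        [ (λ xw → noGreenDetour xw bx w⇝b)
        , (λ wx → noRainbow (blueOut xa) aw (redIn wx) ((λ ()) , (λ ()) , (λ ()))) ]
        (arc-total (λ { refl → arc-asym xa (proj₁ aw) }))

      cycleArc : ∀ {y} → pre y ≡ x → arc x y ≡ true
      cycleArc {y} pre-y≡x = subst (λ t → arc t y ≡ true) pre-y≡x (proj₁ ham y)

      -- The successor y of x does not dominate x⁻: in red it would dominate
      -- x = pre y, in blue the last edge v → x⁻ would let x dominate x⁻, and
      -- a green path is excluded by noGreenDetour.
      noDomFromSuccessor : ∀ {y c} → pre y ≡ x → ¬ Dom D c y (pre x)
      noDomFromSuccessor {y} {red} pre-y≡x y⇝pre =
        noDomPre (subst (Dom D red y) (sym pre-y≡x) (y⇝pre ▷ ∈⊤ by preEdge))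
      noDomFromSuccessor {c = green} pre-y≡x y⇝pre = noGreenDetour (cycleArc pre-y≡x) (proj₁ preEdge) y⇝pre
      noDomFromSuccessor {c = blue} _ y⇝pre with lastEdge ∈⊤ y⇝pre
      ... | v , _ , vp = noDomPre (blueDom v≢x (arc⇒≢ (proj₁ vp)) ▷ ∈⊤ by vp)
        where
        v≢x : v ≢ x
        v≢x refl = arc-asym (proj₁ vp) (proj₁ preEdge)

      contradiction : ⊥
      contradiction with successor x
      ... | y , pre-y≡x with domAll y (pre x) pre≢y pre≢pre-y
        where
        pre≢y : pre x ≢ y
        pre≢y refl = arc-asym (proj₁ preEdge) (cycleArc pre-y≡x)
        pre≢pre-y : pre x ≢ pre y
        pre≢pre-y eq = arc⇒≢ (proj₁ preEdge) (trans eq pre-y≡x)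
      ...   | _ , y⇝pre = noDomFromSuccessor pre-y≡x y⇝pre

    result : B⁻b-nonempty D x
    result with any? (λ v → edge? blue v x)
    ... | yes (v , vx) = blueInNeighbour vx noRedDom
    ... | no none      = ⊥-elim (WithoutBlueIn.contradiction (λ vx → none (_ , vx)))

  B⁻b : B⁻b-nonempty D x
  B⁻b with any? (λ u → edge? red x u)
  ... | yes (u₀ , xu₀) = WithRedOut.result u₀ xu₀
  ... | no none        = WithoutRedOut.result (λ xu → none (_ , xu))

lemma3p3 : {n : ℕ} (D : Tournament3 n) → MinimalCounterexample D →
    (pre : Fin n → Fin n) → IsHamiltonPred D pre → DominatesAllButPred D pre →
    (x : Fin n) → (∀ v → v ≢ x → Tournament3.col D x v ≢ green) →
    Edge D (pre x) x red →
    B⁺b-nonempty D x × B⁻b-nonempty D x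
lemma3p3 D mc pre ham domAll x noGreen preEdge = Tournament.B⁻⇒B⁺ D B⁻b , B⁻b
  where open AtVertex D mc pre ham domAll x noGreen preEdge using (B⁻b)
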